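{- Let $\mathcal{G}_n$ ($n\ge 1$) be the pseudofractal scale-free web: $\mathcal{G}_1$ is the complete graph on $3$ vertices, and for $n>1$, $\mathcal{G}_n$ is obtained from $\mathcal{G}_{n-1}$ by creating, for each edge $\{u,v\}$ of $\mathcal{G}_{n-1}$, a new vertex joined by edges to both $u$ and $v$. Then for every $n\ge 3$, the edge domination number of $\mathcal{G}_n$ is $$\gamma(\mathcal{G}_n)=3^{\,n-2}.$$
   Context: For a finite simple graph with edge set $\mathcal{E}$, an edge dominating set is a subset $\mathcal{F}\subseteq\mathcal{E}$ such that every edge in $\mathcal{E}\setminus\mathcal{F}$ shares at least one endpoint with some edge of $\mathcal{F}$. The edge domination number is the minimum cardinality of an edge dominating set. (The graph $\mathcal{G}_n$ has $3^n$ edges and $(3^n+3)/2$ vertices.) -}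

module Defs where

open import Data.Nat using (ℕ; zero; suc; _+_; _∸_)
open import Data.Product using (_×_; _,_; Σ-syntax)
open import Data.Sum using (_⊎_)
open import Data.List using (List; []; _∷_; _++_; length; lookup)
open import Data.Fin using (Fin)
open import Data.Fin.Subset using (Subset; _∈_; _∉_; ∣_∣)
open import Relation.Binary.PropositionalEquality using (_≡_)

-- A finite simple graph given by a vertex count (vertices 0 .. nv-1)
-- and a list of its edges (each edge listed exactly once, as an
-- unordered pair written as an ordered pair).
record Graph : Set where
  constructor graph
  field
    nv    : ℕ
    edges : List (ℕ × ℕ)
open Graph public

K3 : Graph
K3 = graph 3 ((0 , 1) ∷ (1 , 2) ∷ (0 , 2) ∷ [])

-- for the k-th listed edge {u,v} (counting from vertex label k0), create
-- the new vertex k0 + k joined to u and v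
newEdges : ℕ → List (ℕ × ℕ) → List (ℕ × ℕ)
newEdges k [] = []
newEdges k ((u , v) ∷ es) = (u , k) ∷ (v , k) ∷ newEdges (suc k) es

step : Graph → Graph
step (graph n es) = graph (n + length es) (es ++ newEdges n es)

-- pf k is G_{k+1}
pf : ℕ → Graph
pf zero = K3
pf (suc k) = step (pf k)

G : ℕ → Graph
G n = pf (n ∸ 1)

EdgeIx : Graph → Set
EdgeIx g = Fin (length (edges g))

edgeAt : (g : Graph) → EdgeIx g → ℕ × ℕ
edgeAt g i = lookup (edges g) i

ShareEndpoint : ℕ × ℕ → ℕ × ℕ → Set
ShareEndpoint (a , b) (c , d) = (a ≡ c ⊎ a ≡ d) ⊎ (b ≡ c ⊎ b ≡ d)

IsEdgeDominating : (g : Graph) → Subset (length (edges g)) → Set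
IsEdgeDominating g F =
  (i : EdgeIx g) → i ∉ F → Σ[ j ∈ EdgeIx g ] (j ∈ F × ShareEndpoint (edgeAt g i) (edgeAt g j))

EdgeDominationNumber : Graph → ℕ → Set
EdgeDominationNumber g k =
  (Σ[ F ∈ Subset (length (edges g)) ] (IsEdgeDominating g F × ∣ F ∣ ≡ k))
  × ((F : Subset (length (edges g))) → IsEdgeDominating g F → k Data.Nat.≤ ∣ F ∣)

{-# OPTIONS --safe #-}
module Submission where

-- Write G_n = step (step H) with H = G_{n-2}, which has m = 3^(n-2) edges, and let w_e be the
-- vertex created for the edge e of H in the first step.
-- Lower bound: let y_e be the vertex created in the second step for the first edge between H
-- and w_e.  The edge w_e y_e only touches edges descending from e, so these m edges have
-- pairwise disjoint closed neighbourhoods and a dominating set needs one edge in each.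
-- Upper bound: every edge of G_n has an endpoint in step H, and the m edges w_e v_e, with v_e
-- the second endpoint of e, touch every vertex of step H except the vertex 0 of H; replacing
-- w_(0,2) 2 by w_(0,2) 0 repairs this, as 2 is still reached through w_(1,2).

open import Defs
open import Data.Bool using (Bool; true; false; if_then_else_)
open import Data.Fin as Fin using (Fin; toℕ; fromℕ<)
open import Data.Fin.Properties as Finₚ using (toℕ<n; toℕ-fromℕ<; toℕ-injective; injective⇒≤)
open import Data.Fin.Subset using (Subset; _∈_; ∣_∣)
open import Data.Fin.Subset.Properties using (_∈?_)
open import Data.List using (List; []; _∷_; _++_; length; lookup)
open import Data.List.Properties using (length-++)
open import Data.Nat
open import Data.Nat.Properties
open import Data.Product using (Σ-syntax; ∃-syntax; _×_; _,_; proj₁; proj₂)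
open import Data.Sum using (_⊎_; inj₁; inj₂)
open import Data.Vec using (tabulate; _∷_)
open import Data.Vec.Base using (here; there)
open import Data.Vec.Properties using (lookup∘tabulate; lookup⇒[]=)
open import Function using (_∘_)
open import Function.Definitions using (Injective)
open import Relation.Binary.PropositionalEquality
open import Relation.Nullary using (yes; no; contradiction)

Edge : Set
Edge = ℕ × ℕ

Incident : ℕ → Edge → Set
Incident x e = x ≡ proj₁ e ⊎ x ≡ proj₂ e

Below : ℕ → Edge → Set
Below N e = proj₁ e < N × proj₂ e < N

-- Out of range this returns the junk edge (0 , 0).
_‼_ : List Edge → ℕ → Edge
[]       ‼ _     = 0 , 0
(e ∷ es) ‼ zero  = e
(e ∷ es) ‼ suc p = es ‼ p

lookup≡‼ : (es : List Edge) (i : Fin (length es)) → lookup es i ≡ es ‼ toℕ i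
lookup≡‼ (e ∷ es) Fin.zero    = refl
lookup≡‼ (e ∷ es) (Fin.suc i) = lookup≡‼ es i

lookup-fromℕ< : (es : List Edge) {p : ℕ} (p< : p < length es) → lookup es (fromℕ< p<) ≡ es ‼ p
lookup-fromℕ< es p< = trans (lookup≡‼ es (fromℕ< p<)) (cong (es ‼_) (toℕ-fromℕ< p<))

‼-++ˡ : (es fs : List Edge) {p : ℕ} → p < length es → (es ++ fs) ‼ p ≡ es ‼ p
‼-++ˡ (e ∷ es) fs {zero}  _        = refl
‼-++ˡ (e ∷ es) fs {suc p} (s<s p<) = ‼-++ˡ es fs p<

‼-++ʳ : (es fs : List Edge) (q : ℕ) → (es ++ fs) ‼ (length es + q) ≡ fs ‼ q
‼-++ʳ []       fs q = refl
‼-++ʳ (e ∷ es) fs q = ‼-++ʳ es fs q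

double : ℕ → ℕ
double zero    = zero
double (suc r) = suc (suc (double r))

⌊double/2⌋ : ∀ r → ⌊ double r /2⌋ ≡ r
⌊double/2⌋ zero    = refl
⌊double/2⌋ (suc r) = cong suc (⌊double/2⌋ r)

⌊suc-double/2⌋ : ∀ r → ⌊ suc (double r) /2⌋ ≡ r
⌊suc-double/2⌋ zero    = refl
⌊suc-double/2⌋ (suc r) = cong suc (⌊suc-double/2⌋ r)

suc-double-< : ∀ {r m} → r < m → suc (double r) < double m
suc-double-< {zero}  {suc m} _        = s<s z<s
suc-double-< {suc r} {suc m} (s<s r<) = s<s (s<s (suc-double-< r<))

double-< : ∀ {r m} → r < m → double r < double m
double-< r< = <-trans (n<1+n _) (suc-double-< r<)

m+double≡3*m : ∀ m → m + double m ≡ 3 * m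
m+double≡3*m m = cong (m +_) (double≡ m)
  where
  double≡ : ∀ m → double m ≡ m + (m + 0)
  double≡ zero    = refl
  double≡ (suc m) = cong suc (trans (cong suc (double≡ m)) (sym (+-suc m (m + 0))))

<⊎≡+ : ∀ a p → p < a ⊎ ∃[ q ] p ≡ a + q
<⊎≡+ zero    p       = inj₂ (p , refl)
<⊎≡+ (suc a) zero    = inj₁ z<s
<⊎≡+ (suc a) (suc p) with <⊎≡+ a p
... | inj₁ p<        = inj₁ (s<s p<)
... | inj₂ (q , eq)  = inj₂ (q , cong suc eq)

halve : ∀ m q → q < double m → ∃[ r ] r < m × (q ≡ double r ⊎ q ≡ suc (double r))
halve (suc m) zero          _              = zero , z<s , inj₁ refl
halve (suc m) (suc zero)    _              = zero , z<s , inj₂ refl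
halve (suc m) (suc (suc q)) (s<s (s<s q<)) with halve m q q<
... | r , r< , inj₁ refl = suc r , s<s r< , inj₁ refl
... | r , r< , inj₂ refl = suc r , s<s r< , inj₂ refl

<⇒+≢ : ∀ {N r x} → x < N → N + r ≢ x
<⇒+≢ {N} {r} x<N refl = m+n≮m N r x<N

rank : ∀ {n} (F : Subset n) {j : Fin n} → j ∈ F → Fin ∣ F ∣
rank (true  ∷ F) here        = Fin.zero
rank (true  ∷ F) (there j∈F) = Fin.suc (rank F j∈F)
rank (false ∷ F) (there j∈F) = rank F j∈F

rank-injective : ∀ {n} (F : Subset n) {j k : Fin n} (j∈F : j ∈ F) (k∈F : k ∈ F) →
                 rank F j∈F ≡ rank F k∈F → j ≡ k
rank-injective (true  ∷ F) here        here        _  = refl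
rank-injective (true  ∷ F) (there j∈F) (there k∈F) eq =
  cong Fin.suc (rank-injective F j∈F k∈F (Finₚ.suc-injective eq))
rank-injective (false ∷ F) (there j∈F) (there k∈F) eq = cong Fin.suc (rank-injective F j∈F k∈F eq)

separated⇒≤∣dominating∣ :
  (g : Graph) {k : ℕ} (t : Fin k → EdgeIx g) (block : EdgeIx g → ℕ) →
  (∀ i j → ShareEndpoint (edgeAt g (t i)) (edgeAt g j) → block j ≡ toℕ i) →
  (F : Subset (length (edges g))) → IsEdgeDominating g F → k ≤ ∣ F ∣
separated⇒≤∣dominating∣ g {k} t block separated F dominating = injective⇒≤ {f = rank F ∘ member∈F} injective
  where
  member : (i : Fin k) → Σ[ j ∈ EdgeIx g ] (j ∈ F × block j ≡ toℕ i)
  member i with t i ∈? F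
  ... | yes tᵢ∈F = t i , tᵢ∈F , separated i (t i) (inj₁ (inj₁ refl))
  ... | no tᵢ∉F with dominating (t i) tᵢ∉F
  ...   | j , j∈F , shared = j , j∈F , separated i j shared

  member∈F : (i : Fin k) → proj₁ (member i) ∈ F
  member∈F i = proj₁ (proj₂ (member i))

  injective : Injective _≡_ _≡_ (rank F ∘ member∈F)
  injective {i} {i′} eq = toℕ-injective (begin
    toℕ i                    ≡⟨ sym (proj₂ (proj₂ (member i))) ⟩
    block (proj₁ (member i))  ≡⟨ cong block (rank-injective F (member∈F i) (member∈F i′) eq) ⟩
    block (proj₁ (member i′)) ≡⟨ proj₂ (proj₂ (member i′)) ⟩
    toℕ i′                   ∎)
    where open ≡-Reasoning

first-endpoints-covered⇒dominating :
  (g : Graph) (F : Subset (length (edges g))) →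
  (∀ i → Σ[ j ∈ EdgeIx g ] (j ∈ F × Incident (proj₁ (edgeAt g i)) (edgeAt g j))) →
  IsEdgeDominating g F
first-endpoints-covered⇒dominating g F covered i _ with covered i
... | j , j∈F , incident = j , j∈F , inj₁ incident

countBelow : ℕ → (ℕ → Bool) → ℕ
countBelow zero    f = zero
countBelow (suc n) f = (if f 0 then 1 else 0) + countBelow n (f ∘ suc)

∣tabulate∣≡countBelow : ∀ n (f : ℕ → Bool) → ∣ tabulate {n = n} (f ∘ toℕ) ∣ ≡ countBelow n f
∣tabulate∣≡countBelow zero    f = refl
∣tabulate∣≡countBelow (suc n) f with f 0 | ∣tabulate∣≡countBelow n (f ∘ suc)
... | true  | ih = cong suc ih
... | false | ih = ih

countBelow-+ : ∀ a b f → countBelow (a + b) f ≡ countBelow a f + countBelow b (f ∘ (a +_))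
countBelow-+ zero    b f = refl
countBelow-+ (suc a) b f =
  trans (cong (_ +_) (countBelow-+ a b (f ∘ suc))) (sym (+-assoc (if f 0 then 1 else 0) _ _))

countBelow-cong : ∀ n {f g} → (∀ x → x < n → f x ≡ g x) → countBelow n f ≡ countBelow n g
countBelow-cong zero    f≗g = refl
countBelow-cong (suc n) f≗g =
  cong₂ (λ b c → (if b then 1 else 0) + c) (f≗g 0 z<s) (countBelow-cong n (λ x x< → f≗g (suc x) (s<s x<)))

countBelow-false : ∀ n → countBelow n (λ _ → false) ≡ 0
countBelow-false zero    = refl
countBelow-false (suc n) = countBelow-false n

odd : ℕ → Bool
odd zero          = false
odd (suc zero)    = true
odd (suc (suc n)) = odd n

countBelow-odd : ∀ m → countBelow (double m) odd ≡ m
countBelow-odd zero    = refl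
countBelow-odd (suc m) = cong suc (countBelow-odd m)

chosen : ℕ → Bool
chosen 4 = true
chosen 5 = false
chosen s = odd s

chosen-suc-double : ∀ r → r ≢ 2 → chosen (suc (double r)) ≡ true
chosen-suc-double 0 _ = refl
chosen-suc-double 1 _ = refl
chosen-suc-double 2 r≢2 = contradiction refl r≢2
chosen-suc-double (suc (suc (suc r))) _ = odd-suc-double r
  where
  odd-suc-double : ∀ r → odd (suc (double r)) ≡ true
  odd-suc-double zero    = refl
  odd-suc-double (suc r) = odd-suc-double r

countBelow-chosen : ∀ m → 2 < m → countBelow (double m) chosen ≡ m
countBelow-chosen 1 (s<s ())
countBelow-chosen 2 (s<s (s<s ()))
countBelow-chosen (suc (suc (suc m))) _ = cong (3 +_) (countBelow-odd m)

newEdges-length : ∀ k es → length (newEdges k es) ≡ double (length es)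
newEdges-length k []             = refl
newEdges-length k ((u , v) ∷ es) = cong (suc ∘ suc) (newEdges-length (suc k) es)

newEdges-‼-double : ∀ k es {r} → r < length es → newEdges k es ‼ double r ≡ (proj₁ (es ‼ r) , k + r)
newEdges-‼-double k ((u , v) ∷ es) {zero}  _        = cong (u ,_) (sym (+-identityʳ k))
newEdges-‼-double k ((u , v) ∷ es) {suc r} (s<s r<) =
  trans (newEdges-‼-double (suc k) es r<) (cong (proj₁ (es ‼ r) ,_) (sym (+-suc k r)))

newEdges-‼-suc-double : ∀ k es {r} → r < length es → newEdges k es ‼ suc (double r) ≡ (proj₂ (es ‼ r) , k + r)
newEdges-‼-suc-double k ((u , v) ∷ es) {zero}  _        = cong (v ,_) (sym (+-identityʳ k))
newEdges-‼-suc-double k ((u , v) ∷ es) {suc r} (s<s r<) =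
  trans (newEdges-‼-suc-double (suc k) es r<) (cong (proj₂ (es ‼ r) ,_) (sym (+-suc k r)))

Bounded : ℕ → List Edge → Set
Bounded N es = ∀ p → p < length es → Below N (es ‼ p)

SecondEndpointCover : ℕ → List Edge → Set
SecondEndpointCover N es =
  ∀ x → x < N → x ≡ proj₁ (es ‼ 2) ⊎ Σ[ i ∈ ℕ ] (i < length es × i ≢ 2 × x ≡ proj₂ (es ‼ i))

module Step (N : ℕ) (es : List Edge) where

  m : ℕ
  m = length es

  es⁺ : List Edge
  es⁺ = es ++ newEdges N es

  length-es⁺ : length es⁺ ≡ m + double m
  length-es⁺ = trans (length-++ es) (cong (m +_) (newEdges-length N es))

  ‼-old : ∀ {p} → p < m → es⁺ ‼ p ≡ es ‼ p
  ‼-old = ‼-++ˡ es (newEdges N es)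

  ‼-newˡ : ∀ {r} → r < m → es⁺ ‼ (m + double r) ≡ (proj₁ (es ‼ r) , N + r)
  ‼-newˡ {r} r< = trans (‼-++ʳ es _ (double r)) (newEdges-‼-double N es r<)

  ‼-newʳ : ∀ {r} → r < m → es⁺ ‼ (m + suc (double r)) ≡ (proj₂ (es ‼ r) , N + r)
  ‼-newʳ {r} r< = trans (‼-++ʳ es _ (suc (double r))) (newEdges-‼-suc-double N es r<)

  data Position : ℕ → Set where
    old  : ∀ {p} → p < m → Position p
    newˡ : ∀ {r} → r < m → Position (m + double r)
    newʳ : ∀ {r} → r < m → Position (m + suc (double r))

  position : ∀ {p} → p < length es⁺ → Position p
  position {p} p< with <⊎≡+ m p
  ... | inj₁ p<m = old p<m
  ... | inj₂ (q , refl) with halve m q (+-cancelˡ-< m q (double m) (subst (m + q <_) length-es⁺ p<))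
  ...   | r , r< , inj₁ refl = newˡ r<
  ...   | r , r< , inj₂ refl = newʳ r<

  -- the edge of es that edge p of es⁺ is, or was created from
  origin : ℕ → ℕ
  origin p with p <? m
  ... | yes _ = p
  ... | no _  = ⌊ p ∸ m /2⌋

  origin-old : ∀ {p} → p < m → origin p ≡ p
  origin-old {p} p<m with p <? m
  ... | yes _   = refl
  ... | no p≮m = contradiction p<m p≮m

  origin-newˡ : ∀ r → origin (m + double r) ≡ r
  origin-newˡ r with m + double r <? m
  ... | yes m+2r<m = contradiction m+2r<m (m+n≮m m (double r))
  ... | no _       = trans (cong ⌊_/2⌋ (m+n∸m≡n m (double r))) (⌊double/2⌋ r)

  origin-newʳ : ∀ r → origin (m + suc (double r)) ≡ r
  origin-newʳ r with m + suc (double r) <? m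
  ... | yes m+2r+1<m = contradiction m+2r+1<m (m+n≮m m (suc (double r)))
  ... | no _         = trans (cong ⌊_/2⌋ (m+n∸m≡n m (suc (double r)))) (⌊suc-double/2⌋ r)

  module _ (bounded : Bounded N es) where

    bounded⁺ : Bounded (N + m) es⁺
    bounded⁺ p p< with position p<
    ... | old p<m rewrite ‼-old p<m =
      m≤n⇒m≤n+o m (proj₁ (bounded p p<m)) , m≤n⇒m≤n+o m (proj₂ (bounded p p<m))
    ... | newˡ {r} r< rewrite ‼-newˡ r< = m≤n⇒m≤n+o m (proj₁ (bounded r r<)) , +-monoʳ-< N r<
    ... | newʳ {r} r< rewrite ‼-newʳ r< = m≤n⇒m≤n+o m (proj₂ (bounded r r<)) , +-monoʳ-< N r<

    first-endpoint-below : ∀ p → p < length es⁺ → proj₁ (es⁺ ‼ p) < N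
    first-endpoint-below p p< with position p<
    ... | old p<m     rewrite ‼-old p<m = proj₁ (bounded p p<m)
    ... | newˡ {r} r< rewrite ‼-newˡ r< = proj₁ (bounded r r<)
    ... | newʳ {r} r< rewrite ‼-newʳ r< = proj₂ (bounded r r<)

    incident-new : ∀ {p r} → p < length es⁺ → Incident (N + r) (es⁺ ‼ p) → origin p ≡ r
    incident-new {p} {r} p< incident with position p<
    ... | old p<m with subst (Incident (N + r)) (‼-old p<m) incident
    ...   | inj₁ e = contradiction e (<⇒+≢ (proj₁ (bounded p p<m)))
    ...   | inj₂ e = contradiction e (<⇒+≢ (proj₂ (bounded p p<m)))
    incident-new {r = r} p< incident | newˡ {r′} r′< with subst (Incident (N + r)) (‼-newˡ r′<) incident
    ...   | inj₁ e = contradiction e (<⇒+≢ (proj₁ (bounded r′ r′<)))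
    ...   | inj₂ e = trans (origin-newˡ r′) (sym (+-cancelˡ-≡ N r r′ e))
    incident-new {r = r} p< incident | newʳ {r′} r′< with subst (Incident (N + r)) (‼-newʳ r′<) incident
    ...   | inj₁ e = contradiction e (<⇒+≢ (proj₂ (bounded r′ r′<)))
    ...   | inj₂ e = trans (origin-newʳ r′) (sym (+-cancelˡ-≡ N r r′ e))

    incident-old : ∀ {p x} → x < N → p < length es⁺ → Incident x (es⁺ ‼ p) →
                   origin p < m × Incident x (es ‼ origin p)
    incident-old {p} {x} x<N p< incident with position p<
    ... | old p<m rewrite origin-old p<m = p<m , subst (Incident x) (‼-old p<m) incident
    ... | newˡ {r} r< rewrite origin-newˡ r with subst (Incident x) (‼-newˡ r<) incident
    ...   | inj₁ e = r< , inj₁ e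
    ...   | inj₂ e = contradiction (sym e) (<⇒+≢ x<N)
    incident-old {x = x} x<N p< incident | newʳ {r} r< rewrite origin-newʳ r
      with subst (Incident x) (‼-newʳ r<) incident
    ...   | inj₁ e = r< , inj₂ e
    ...   | inj₂ e = contradiction (sym e) (<⇒+≢ x<N)

  cover⁺ : 2 < m → SecondEndpointCover N es → SecondEndpointCover (N + m) es⁺
  cover⁺ 2<m cover x x< with <⊎≡+ N x
  ... | inj₁ x<N with cover x x<N
  ...   | inj₁ e = inj₁ (trans e (cong proj₁ (sym (‼-old 2<m))))
  ...   | inj₂ (i , i< , i≢2 , e) =
          inj₂ (i , <-≤-trans i< (subst (m ≤_) (sym length-es⁺) (m≤m+n m _)) , i≢2 , trans e (cong proj₂ (sym (‼-old i<))))
  cover⁺ 2<m cover x x< | inj₂ (r , refl) =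
    inj₂ (m + suc (double r) , subst (m + suc (double r) <_) (sym length-es⁺) (+-monoʳ-< m (suc-double-< r<)) ,
          >⇒≢ (<-≤-trans 2<m (m≤m+n m _)) , sym (cong proj₂ (‼-newʳ r<)))
    where r< = +-cancelˡ-< N r m x<

module TwoSteps (N : ℕ) (es : List Edge) (bounded : Bounded N es)
                (cover : SecondEndpointCover N es) (2<m : 2 < length es) where

  module S₁ = Step N es
  module S₂ = Step (N + S₁.m) S₁.es⁺

  m : ℕ
  m = S₁.m

  E₃ : List Edge
  E₃ = S₂.es⁺

  g : Graph
  g = step (step (graph N es))

  bounded₂ : Bounded (N + m) S₁.es⁺
  bounded₂ = S₁.bounded⁺ bounded

  -- Edge i of es gets the vertex N + i in the first step; its first new edge, at position
  -- m + double i, gets the vertex N + m + (m + double i) in the second step.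
  separator : ℕ → ℕ
  separator i = S₂.m + suc (double (m + double i))

  new₁< : ∀ {s} → s < double m → m + s < S₂.m
  new₁< {s} s< = subst (m + s <_) (sym S₁.length-es⁺) (+-monoʳ-< m s<)

  separator< : ∀ {i} → i < m → separator i < length E₃
  separator< {i} i< =
    subst (separator i <_) (sym S₂.length-es⁺) (+-monoʳ-< S₂.m (suc-double-< (new₁< (double-< i<))))

  E₃-separator : ∀ {i} → i < m → E₃ ‼ separator i ≡ (N + i , N + m + (m + double i))
  E₃-separator {i} i< = begin
    E₃ ‼ separator i
      ≡⟨ S₂.‼-newʳ (new₁< (double-< i<)) ⟩
    (proj₂ (S₁.es⁺ ‼ (m + double i)) , N + m + (m + double i))
      ≡⟨ cong (λ e → proj₂ e , N + m + (m + double i)) (S₁.‼-newˡ i<) ⟩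
    (N + i , N + m + (m + double i)) ∎
    where open ≡-Reasoning

  block : ℕ → ℕ
  block p = S₁.origin (S₂.origin p)

  separated : ∀ {i p} → i < m → p < length E₃ → ShareEndpoint (E₃ ‼ separator i) (E₃ ‼ p) → block p ≡ i
  separated {i} {p} i< p< shared with subst (λ e → ShareEndpoint e (E₃ ‼ p)) (E₃-separator i<) shared
  ... | inj₁ incident with S₂.incident-old bounded₂ (+-monoʳ-< N i<) p< incident
  ...   | origin< , incident′ = S₁.incident-new bounded origin< incident′
  separated {i} i< p< shared | inj₂ incident = trans (cong S₁.origin (S₂.incident-new bounded₂ p< incident)) (S₁.origin-newˡ i)

  lower-bound : (F : Subset (length E₃)) → IsEdgeDominating g F → m ≤ ∣ F ∣
  lower-bound = separated⇒≤∣dominating∣ g t (block ∘ toℕ) separatedᶠ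
    where
    t : Fin m → EdgeIx g
    t i = fromℕ< (separator< (toℕ<n i))

    separatedᶠ : ∀ i j → ShareEndpoint (edgeAt g (t i)) (edgeAt g j) → block (toℕ j) ≡ toℕ i
    separatedᶠ i j = separated (toℕ<n i) (toℕ<n j)
                   ∘ subst₂ ShareEndpoint (lookup-fromℕ< E₃ (separator< (toℕ<n i))) (lookup≡‼ E₃ j)

  -- Positions m + s with s < double m hold the edges created in the first step.
  selected : ℕ → Bool
  selected p with p <? m | p <? S₂.m
  ... | yes _ | _     = false
  ... | no _  | yes _ = chosen (p ∸ m)
  ... | no _  | no _  = false

  selected-old : ∀ p → p < m → selected p ≡ false
  selected-old p p< with p <? m
  ... | yes _ = refl
  ... | no p≮ = contradiction p< p≮

  selected-new₁ : ∀ s → s < double m → selected (m + s) ≡ chosen s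
  selected-new₁ s s< with m + s <? m | m + s <? S₂.m
  ... | yes m+s<m | _     = contradiction m+s<m (m+n≮m m s)
  ... | no _      | yes _ = cong chosen (m+n∸m≡n m s)
  ... | no _      | no m+s≮L = contradiction (new₁< s<) m+s≮L

  selected-new₂ : ∀ x → selected (S₂.m + x) ≡ false
  selected-new₂ x with S₂.m + x <? m | S₂.m + x <? S₂.m
  ... | yes _ | _         = refl
  ... | no _  | yes L+x<L = contradiction L+x<L (m+n≮m S₂.m x)
  ... | no _  | no _      = refl

  F₀ : Subset (length E₃)
  F₀ = tabulate (selected ∘ toℕ)

  countBelow-selected-es⁺ : countBelow S₂.m selected ≡ m
  countBelow-selected-es⁺ = begin
    countBelow S₂.m selected
      ≡⟨ cong (λ n → countBelow n selected) S₁.length-es⁺ ⟩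
    countBelow (m + double m) selected
      ≡⟨ countBelow-+ m (double m) selected ⟩
    countBelow m selected + countBelow (double m) (selected ∘ (m +_))
      ≡⟨ cong₂ _+_ (countBelow-cong m selected-old) (countBelow-cong (double m) selected-new₁) ⟩
    countBelow m (λ _ → false) + countBelow (double m) chosen
      ≡⟨ cong₂ _+_ (countBelow-false m) (countBelow-chosen m 2<m) ⟩
    m ∎
    where open ≡-Reasoning

  ∣F₀∣ : ∣ F₀ ∣ ≡ m
  ∣F₀∣ = begin
    ∣ F₀ ∣
      ≡⟨ ∣tabulate∣≡countBelow (length E₃) selected ⟩
    countBelow (length E₃) selected
      ≡⟨ cong (λ n → countBelow n selected) S₂.length-es⁺ ⟩
    countBelow (S₂.m + double S₂.m) selected
      ≡⟨ countBelow-+ S₂.m (double S₂.m) selected ⟩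
    countBelow S₂.m selected + countBelow (double S₂.m) (selected ∘ (S₂.m +_))
      ≡⟨ cong₂ _+_ countBelow-selected-es⁺ (countBelow-cong (double S₂.m) (λ x _ → selected-new₂ x)) ⟩
    m + countBelow (double S₂.m) (λ _ → false)
      ≡⟨ cong (m +_) (countBelow-false (double S₂.m)) ⟩
    m + 0
      ≡⟨ +-identityʳ m ⟩
    m ∎
    where open ≡-Reasoning

  SelectedIncident : ℕ → Set
  SelectedIncident x = Σ[ p ∈ ℕ ] Σ[ p< ∈ p < length E₃ ] (selected p ≡ true × Incident x (E₃ ‼ p))

  new₁-selected-incident : ∀ {x} s → s < double m → chosen s ≡ true →
                           Incident x (S₁.es⁺ ‼ (m + s)) → SelectedIncident x
  new₁-selected-incident {x} s s< chosen-s incident =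
    m + s , <-≤-trans (new₁< s<) (subst (S₂.m ≤_) (sym S₂.length-es⁺) (m≤m+n S₂.m _)) ,
    trans (selected-new₁ s s<) chosen-s , subst (Incident x) (sym (S₂.‼-old (new₁< s<))) incident

  selected-cover : ∀ x → x < N + m → SelectedIncident x
  selected-cover x x< with <⊎≡+ N x
  ... | inj₁ x<N with cover x x<N
  ...   | inj₁ e = new₁-selected-incident 4 (double-< 2<m) refl
                     (inj₁ (trans e (sym (cong proj₁ (S₁.‼-newˡ 2<m)))))
  ...   | inj₂ (i , i< , i≢2 , e) = new₁-selected-incident (suc (double i)) (suc-double-< i<) (chosen-suc-double i i≢2)
                                      (inj₁ (trans e (sym (cong proj₁ (S₁.‼-newʳ i<)))))
  selected-cover x x< | inj₂ (r , refl) with r ≟ 2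
  ... | yes refl = new₁-selected-incident 4 (double-< 2<m) refl (inj₂ (sym (cong proj₂ (S₁.‼-newˡ 2<m))))
  ... | no r≢2   = new₁-selected-incident (suc (double r)) (suc-double-< r<) (chosen-suc-double r r≢2)
                     (inj₂ (sym (cong proj₂ (S₁.‼-newʳ r<))))
    where r< = +-cancelˡ-< N r m x<

  F₀-dominating : IsEdgeDominating g F₀
  F₀-dominating = first-endpoints-covered⇒dominating g F₀ covered
    where
    covered : ∀ i → Σ[ j ∈ EdgeIx g ] (j ∈ F₀ × Incident (proj₁ (edgeAt g i)) (edgeAt g j))
    covered i with selected-cover (proj₁ (edgeAt g i))
                     (subst (λ e → proj₁ e < N + m) (sym (lookup≡‼ E₃ i))
                       (S₂.first-endpoint-below bounded₂ (toℕ i) (toℕ<n i)))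
    ... | p , p< , selected-p , incident =
      fromℕ< p< ,
      lookup⇒[]= (fromℕ< p<) F₀ (trans (lookup∘tabulate (selected ∘ toℕ) (fromℕ< p<))
                                   (trans (cong selected (toℕ-fromℕ< p<)) selected-p)) ,
      subst (Incident _) (sym (lookup-fromℕ< E₃ p<)) incident

  edgeDominationNumber : EdgeDominationNumber g m
  edgeDominationNumber = (F₀ , F₀-dominating , ∣F₀∣) , lower-bound

bounded-pf : ∀ j → Bounded (nv (pf j)) (edges (pf j))
bounded-pf zero 0 _ = z<s , s<s z<s
bounded-pf zero 1 _ = s<s z<s , s<s (s<s z<s)
bounded-pf zero 2 _ = z<s , s<s (s<s z<s)
bounded-pf zero (suc (suc (suc p))) (s<s (s<s (s<s ())))
bounded-pf (suc j) = Step.bounded⁺ (nv (pf j)) (edges (pf j)) (bounded-pf j)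

length-pf : ∀ j → length (edges (pf j)) ≡ 3 ^ suc j
length-pf zero    = refl
length-pf (suc j) = begin
  length (edges (pf (suc j)))  ≡⟨ Step.length-es⁺ (nv (pf j)) (edges (pf j)) ⟩
  m + double m                 ≡⟨ m+double≡3*m m ⟩
  3 * m                        ≡⟨ cong (3 *_) (length-pf j) ⟩
  3 ^ suc (suc j)              ∎
  where
  open ≡-Reasoning
  m = length (edges (pf j))

2<length-pf : ∀ j → 2 < length (edges (pf j))
2<length-pf j = subst (2 <_) (sym (length-pf j)) (*-monoʳ-≤ 3 (m^n>0 3 j))

cover-pf : ∀ j → SecondEndpointCover (nv (pf j)) (edges (pf j))
cover-pf zero 0 _ = inj₁ refl
cover-pf zero 1 _ = inj₂ (0 , z<s , (λ ()) , refl)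
cover-pf zero 2 _ = inj₂ (1 , s<s z<s , (λ ()) , refl)
cover-pf zero (suc (suc (suc x))) (s<s (s<s (s<s ())))
cover-pf (suc j) = Step.cover⁺ (nv (pf j)) (edges (pf j)) (2<length-pf j) (cover-pf j)

theorem1 : (n : ℕ) → 3 ≤ n → EdgeDominationNumber (G n) (3 ^ (n ∸ 2))
theorem1 1 (s≤s ())
theorem1 2 (s≤s (s≤s ()))
theorem1 (suc (suc (suc j))) _ =
  subst (EdgeDominationNumber (G (3 + j))) (length-pf j)
    (TwoSteps.edgeDominationNumber (nv (pf j)) (edges (pf j)) (bounded-pf j) (cover-pf j) (2<length-pf j))
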